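{- There exist a connected graph $G$ of order $n\geq 2$ and a graph $H$ with $k\geq 1$ connected components $H_1,\ldots,H_k$ such that $\chi_L(G\odot H)=\chi_L(G)+\sum_{t=1}^{k}\bigl(\chi_L(H_t+K_1)-1\bigr)$.
   Context: All graphs are finite and simple. For a connected graph $G$, a $k$-coloring is a map $c:V(G)\to\{1,\ldots,k\}$ with $c(u)\neq c(v)$ whenever $uv\in E(G)$; it induces the partition $\Pi=\{C_1,\ldots,C_k\}$ into color classes. The color code of $v$ is $c_\Pi(v)=(d(v,C_1),\ldots,d(v,C_k))$, where $d(v,C_i)=\min\{d(v,x): x\in C_i\}$. The coloring is locating if distinct vertices have distinct color codes; $\chi_L(G)$ is the least $k$ admitting a locating $k$-coloring. The corona product $G\odot H$ (for $V(G)=\{a_1,\ldots,a_n\}$) is obtained from one copy of $G$ and $n$ copies of $H$ by joining $a_i$ to every vertex of the $i$-th copy of $H$. $H_t+K_1$ denotes the join of $H_t$ with a single new vertex adjacent to all vertices of $H_t$. -}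

module Defs where

open import Data.Nat using (ℕ; zero; suc; _+_; _*_; _∸_; _≤_)
open import Data.Fin using (Fin; zero; suc; splitAt; remQuot; _≟_)
open import Data.Bool using (Bool; true; false; _∧_)
open import Data.Sum using (_⊎_; inj₁; inj₂)
open import Data.Product using (Σ; ∃; _×_; _,_)
open import Data.List using (List; []; _∷_)
open import Relation.Nullary using (¬_)
open import Relation.Nullary.Decidable using (⌊_⌋)
open import Relation.Binary.PropositionalEquality using (_≡_; _≢_)
open import Function.Definitions using (Surjective)

record Graph : Set where
  constructor mkGraph
  field
    order : ℕ
    adj   : Fin order → Fin order → Bool
open Graph public

Simple : Graph → Set
Simple G = (∀ u v → adj G u v ≡ adj G v u) × (∀ u → adj G u u ≡ false)

data Walk (G : Graph) : Fin (order G) → Fin (order G) → ℕ → Set where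
  here : ∀ {u} → Walk G u u 0
  step : ∀ {u w v l} → adj G u w ≡ true → Walk G w v l → Walk G u v (suc l)

Connected : Graph → Set
Connected G = (1 ≤ order G) × (∀ u v → ∃ λ l → Walk G u v l)

Proper : (G : Graph) {k : ℕ} → (Fin (order G) → Fin k) → Set
Proper G c = ∀ u v → adj G u v ≡ true → c u ≢ c v

-- d(v, C_i) = d, where C_i = c⁻¹(i): some vertex of colour i is at walk
-- distance d from v, and every walk from v into C_i has length ≥ d.
ClassDist : (G : Graph) {k : ℕ} → (Fin (order G) → Fin k) → Fin (order G) → Fin k → ℕ → Set
ClassDist G c v i d =
  (∃ λ x → c x ≡ i × Walk G v x d) × (∀ x l → c x ≡ i → Walk G v x l → d ≤ l)

-- Locating k-coloring: proper, all k colour classes nonempty (a partition into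
-- k classes), and distinct vertices have distinct colour codes.
Locating : (G : Graph) (k : ℕ) → (Fin (order G) → Fin k) → Set
Locating G k c =
  Proper G c × Surjective _≡_ _≡_ c ×
  (∀ u v → u ≢ v → ∃ λ i → ∃ λ d → ∃ λ e → ClassDist G c u i d × ClassDist G c v i e × d ≢ e)

HasLocatingColoring : Graph → ℕ → Set
HasLocatingColoring G k = ∃ λ (c : Fin (order G) → Fin k) → Locating G k c

LocChrom : Graph → ℕ → Set
LocChrom G k = HasLocatingColoring G k × (∀ j → suc j ≤ k → ¬ HasLocatingColoring G j)

_⊕_ : Graph → Graph → Graph
G ⊕ H = mkGraph (order G + order H) a
  where
  a : Fin (order G + order H) → Fin (order G + order H) → Bool
  a x y with splitAt (order G) x | splitAt (order G) y
  ... | inj₁ u | inj₁ v = adj G u v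
  ... | inj₂ u | inj₂ v = adj H u v
  ... | _      | _      = false

emptyGraph : Graph
emptyGraph = mkGraph 0 (λ ())

-- Disjoint union of a list of graphs (its components, when each is connected).
unionAll : List Graph → Graph
unionAll []       = emptyGraph
unionAll (H ∷ Hs) = H ⊕ unionAll Hs

-- H + K₁: new vertex zero adjacent to all vertices of H (shifted by suc).
joinK1 : Graph → Graph
joinK1 H = mkGraph (suc (order H)) a
  where
  a : Fin (suc (order H)) → Fin (suc (order H)) → Bool
  a zero    zero    = false
  a zero    (suc _) = true
  a (suc _) zero    = true
  a (suc u) (suc v) = adj H u v

-- Corona G ⊙ H: vertices Fin (n + n * m); the first n are a_1..a_n of G,
-- vertex remQuot-encoding (i , h) is vertex h of the i-th copy of H.
corona : Graph → Graph → Graph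
corona G H = mkGraph (order G + order G * order H) a
  where
  a : Fin (order G + order G * order H) → Fin (order G + order G * order H) → Bool
  a x y with splitAt (order G) x | splitAt (order G) y
  ... | inj₁ i | inj₁ j = adj G i j
  ... | inj₁ i | inj₂ q with remQuot {order G} (order H) q
  ...   | (j , _) = ⌊ i ≟ j ⌋
  a x y | inj₂ p | inj₁ j with remQuot {order G} (order H) p
  ...   | (i , _) = ⌊ i ≟ j ⌋
  a x y | inj₂ p | inj₂ q with remQuot {order G} (order H) p | remQuot {order G} (order H) q
  ...   | (i , h) | (j , h') = ⌊ i ≟ j ⌋ ∧ adj H h h'

-- K₂ ⊙ K₁ is the path P₄, and K₁ + K₁ is K₂ again. A graph with an edge needs two colours,
-- and K₂ is located by two. P₄ is not: with two colours, the two vertices adjacent to an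
-- inner vertex share a colour and hence the code (0, 1); a three-colouring locates it.
-- So χ_L(K₂ ⊙ K₁) = 3 = 2 + (2 − 1).
module Submission where

open import Defs
open import Data.Nat using (ℕ; zero; suc; _+_; _∸_; _≤_; z≤n; s≤s)
open import Data.Nat.Properties using (≤-antisym)
open import Data.Fin using (Fin; zero; suc; _≟_)
open import Data.Bool using (true; false)
open import Data.Product using (∃; _×_; _,_)
open import Data.List using (List; []; _∷_; length; map)
open import Data.Nat.ListAction using (sum)
open import Data.List.Relation.Unary.All using (All; []; _∷_)
open import Data.List.Relation.Binary.Pointwise using (Pointwise; []; _∷_)
open import Data.Empty using (⊥-elim)
open import Relation.Nullary using (¬_; yes; no)
open import Relation.Binary.PropositionalEquality using (_≡_; _≢_; refl; sym; trans)
open import Function.Definitions using (Surjective)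
open import Function.Consequences.Propositional using (strictlySurjective⇒surjective)

module _ (G : Graph) {k : ℕ} (c : Fin (order G) → Fin k) where

  classDist-unique : ∀ {v i d e} → ClassDist G c v i d → ClassDist G c v i e → d ≡ e
  classDist-unique ((x , cx , wx) , min-d) ((y , cy , wy) , min-e) =
    ≤-antisym (min-d y _ cy wy) (min-e x _ cx wx)

  classDist-self : ∀ {u i} → c u ≡ i → ClassDist G c u i 0
  classDist-self {u} cu = (u , cu , here) , λ _ _ _ _ → z≤n

  classDist-adjacent : ∀ {u w i} → adj G u w ≡ true → c w ≡ i → c u ≢ i → ClassDist G c u i 1
  classDist-adjacent {u} {w} {i} uw cw cu = (w , cw , step uw here) , min
    where
    min : ∀ x l → c x ≡ i → Walk G u x l → 1 ≤ l
    min x .0 cx here       = ⊥-elim (cu cx)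
    min x _  cx (step _ _) = s≤s z≤n

  classDist-two : ∀ {u w x i} → adj G u w ≡ true → adj G w x ≡ true → c x ≡ i → c u ≢ i →
                  (∀ w → adj G u w ≡ true → c w ≢ i) → ClassDist G c u i 2
  classDist-two {u} {w} {x} {i} uw wx cx cu nbrs = (x , cx , step uw (step wx here)) , min
    where
    min : ∀ y l → c y ≡ i → Walk G u y l → 2 ≤ l
    min y .0 cy here                = ⊥-elim (cu cy)
    min y _  cy (step uy here)      = ⊥-elim (nbrs y uy cy)
    min y _  cy (step _ (step _ _)) = s≤s (s≤s z≤n)

  locating-by-codes : (code : Fin (order G) → Fin k → ℕ) →
                      (∀ u i → ClassDist G c u i (code u i)) →
                      (∀ u v → u ≢ v → ∃ λ i → code u i ≢ code v i) →
                      Proper G c → Surjective _≡_ _≡_ c → Locating G k c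
  locating-by-codes code dist separates proper onto = proper , onto , locates
    where
    locates : ∀ u v → u ≢ v → ∃ λ i → ∃ λ d → ∃ λ e →
              ClassDist G c u i d × ClassDist G c v i e × d ≢ e
    locates u v u≢v with separates u v u≢v
    ... | i , differ = i , code u i , code v i , dist u i , dist v i , differ

Fin2-≢-≢ : (a b d : Fin 2) → a ≢ b → a ≢ d → b ≡ d
Fin2-≢-≢ zero       zero       _          a≢b _   = ⊥-elim (a≢b refl)
Fin2-≢-≢ zero       (suc zero) zero       _   a≢d = ⊥-elim (a≢d refl)
Fin2-≢-≢ zero       (suc zero) (suc zero) _   _   = refl
Fin2-≢-≢ (suc zero) zero       zero       _   _   = refl
Fin2-≢-≢ (suc zero) zero       (suc zero) _   a≢d = ⊥-elim (a≢d refl)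
Fin2-≢-≢ (suc zero) (suc zero) _          a≢b _   = ⊥-elim (a≢b refl)

¬locating-≤1 : (G : Graph) {u v : Fin (order G)} → adj G u v ≡ true →
               ∀ {j} → j ≤ 1 → ¬ HasLocatingColoring G j
¬locating-≤1 G {u} uv z≤n       (c , _) with c u
... | ()
¬locating-≤1 G {u} {v} uv (s≤s z≤n) (c , proper , _) with c u | c v | proper u v uv
... | zero | zero | c≢ = c≢ refl

¬locating-2-commonNeighbour : (G : Graph) {u v w : Fin (order G)} → u ≢ v →
                              adj G u w ≡ true → adj G v w ≡ true → ¬ HasLocatingColoring G 2
¬locating-2-commonNeighbour G {u} {v} {w} u≢v uw vw (c , proper , _ , locates)
  with locates u v u≢v
... | i , d , e , du , dv , d≢e with c u ≟ i
... | yes cu≡i = d≢e (trans (classDist-unique G c du (classDist-self G c cu≡i))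
                           (sym (classDist-unique G c dv (classDist-self G c cv≡i))))
  where
  cv≡i : c v ≡ i
  cv≡i = trans (sym (Fin2-≢-≢ (c w) (c u) (c v) (λ eq → proper u w uw (sym eq))
                                               (λ eq → proper v w vw (sym eq)))) cu≡i
... | no cu≢i = d≢e (trans (classDist-unique G c du (classDist-adjacent G c uw cw≡i cu≢i))
                          (sym (classDist-unique G c dv (classDist-adjacent G c vw cw≡i cv≢i))))
  where
  cw≡i : c w ≡ i
  cw≡i = Fin2-≢-≢ (c u) (c w) i (proper u w uw) cu≢i
  cv≢i : c v ≢ i
  cv≢i cv≡i = proper v w vw (trans cv≡i (sym cw≡i))

K₁ : Graph
K₁ = mkGraph 1 (λ _ _ → false)

K₂ : Graph
K₂ = joinK1 K₁

simple-K₁ : Simple K₁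
simple-K₁ = (λ _ _ → refl) , (λ _ → refl)

connected-K₁ : Connected K₁
connected-K₁ = s≤s z≤n , λ { zero zero → 0 , here }

simple-K₂ : Simple K₂
simple-K₂ = (λ { zero zero → refl ; zero (suc zero) → refl ; (suc zero) zero → refl ; (suc zero) (suc zero) → refl })
          , (λ { zero → refl ; (suc zero) → refl })

connected-K₂ : Connected K₂
connected-K₂ = s≤s z≤n , λ { zero zero → 0 , here ; zero (suc zero) → 1 , step refl here
                           ; (suc zero) zero → 1 , step refl here ; (suc zero) (suc zero) → 0 , here }

codes-K₂ : Fin 2 → Fin 2 → ℕ
codes-K₂ zero       zero       = 0
codes-K₂ zero       (suc zero) = 1
codes-K₂ (suc zero) zero       = 1
codes-K₂ (suc zero) (suc zero) = 0

locating-K₂ : Locating K₂ 2 (λ v → v)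
locating-K₂ = locating-by-codes K₂ _ codes-K₂ dist separates proper
                                (strictlySurjective⇒surjective (λ y → y , refl))
  where
  dist : ∀ u i → ClassDist K₂ (λ v → v) u i (codes-K₂ u i)
  dist zero       zero       = classDist-self K₂ _ refl
  dist zero       (suc zero) = classDist-adjacent K₂ _ refl refl (λ ())
  dist (suc zero) zero       = classDist-adjacent K₂ _ refl refl (λ ())
  dist (suc zero) (suc zero) = classDist-self K₂ _ refl
  separates : ∀ u v → u ≢ v → ∃ λ i → codes-K₂ u i ≢ codes-K₂ v i
  separates zero       zero       u≢v = ⊥-elim (u≢v refl)
  separates zero       (suc zero) _   = zero , λ ()
  separates (suc zero) zero       _   = zero , λ ()
  separates (suc zero) (suc zero) u≢v = ⊥-elim (u≢v refl)
  proper : Proper K₂ (λ v → v)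
  proper zero       zero       ()
  proper zero       (suc zero) _  ()
  proper (suc zero) zero       _  ()
  proper (suc zero) (suc zero) ()

locChrom-K₂ : LocChrom K₂ 2
locChrom-K₂ = (_ , locating-K₂) , λ { j (s≤s j≤1) → ¬locating-≤1 K₂ {zero} {suc zero} refl j≤1 }

-- Vertices 0, 1 are those of K₂ and 2, 3 the pendant vertices at 0, 1: the path 2 – 0 – 1 – 3.
P₄ : Graph
P₄ = corona K₂ (unionAll (K₁ ∷ []))

colouring-P₄ : Fin 4 → Fin 3
colouring-P₄ zero                   = suc zero
colouring-P₄ (suc zero)             = suc (suc zero)
colouring-P₄ (suc (suc zero))       = zero
colouring-P₄ (suc (suc (suc zero))) = zero

codes-P₄ : Fin 4 → Fin 3 → ℕ
codes-P₄ zero                   zero             = 1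
codes-P₄ zero                   (suc zero)       = 0
codes-P₄ zero                   (suc (suc zero)) = 1
codes-P₄ (suc zero)             zero             = 1
codes-P₄ (suc zero)             (suc zero)       = 1
codes-P₄ (suc zero)             (suc (suc zero)) = 0
codes-P₄ (suc (suc zero))       zero             = 0
codes-P₄ (suc (suc zero))       (suc zero)       = 1
codes-P₄ (suc (suc zero))       (suc (suc zero)) = 2
codes-P₄ (suc (suc (suc zero))) zero             = 0
codes-P₄ (suc (suc (suc zero))) (suc zero)       = 2
codes-P₄ (suc (suc (suc zero))) (suc (suc zero)) = 1

locating-P₄ : Locating P₄ 3 colouring-P₄
locating-P₄ = locating-by-codes P₄ colouring-P₄ codes-P₄ dist separates proper onto
  where
  c = colouring-P₄
  v0 v1 v2 v3 : Fin 4
  v0 = zero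
  v1 = suc zero
  v2 = suc (suc zero)
  v3 = suc (suc (suc zero))
  dist : ∀ u i → ClassDist P₄ c u i (codes-P₄ u i)
  dist zero                   zero             = classDist-adjacent P₄ c {w = v2} refl refl (λ ())
  dist zero                   (suc zero)       = classDist-self P₄ c refl
  dist zero                   (suc (suc zero)) = classDist-adjacent P₄ c {w = v1} refl refl (λ ())
  dist (suc zero)             zero             = classDist-adjacent P₄ c {w = v3} refl refl (λ ())
  dist (suc zero)             (suc zero)       = classDist-adjacent P₄ c {w = v0} refl refl (λ ())
  dist (suc zero)             (suc (suc zero)) = classDist-self P₄ c refl
  dist (suc (suc zero))       zero             = classDist-self P₄ c refl
  dist (suc (suc zero))       (suc zero)       = classDist-adjacent P₄ c {w = v0} refl refl (λ ())
  dist (suc (suc zero))       (suc (suc zero)) = classDist-two P₄ c {w = v0} {x = v1} refl refl refl (λ ()) nbrs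
    where
    nbrs : ∀ w → adj P₄ v2 w ≡ true → c w ≢ suc (suc zero)
    nbrs zero                   _  ()
    nbrs (suc zero)             ()
    nbrs (suc (suc zero))       ()
    nbrs (suc (suc (suc zero))) ()
  dist (suc (suc (suc zero))) zero             = classDist-self P₄ c refl
  dist (suc (suc (suc zero))) (suc zero)       = classDist-two P₄ c {w = v1} {x = v0} refl refl refl (λ ()) nbrs
    where
    nbrs : ∀ w → adj P₄ v3 w ≡ true → c w ≢ suc zero
    nbrs zero                   ()
    nbrs (suc zero)             _  ()
    nbrs (suc (suc zero))       ()
    nbrs (suc (suc (suc zero))) ()
  dist (suc (suc (suc zero))) (suc (suc zero)) = classDist-adjacent P₄ c {w = v1} refl refl (λ ())
  separates : ∀ u v → u ≢ v → ∃ λ i → codes-P₄ u i ≢ codes-P₄ v i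
  separates zero                   zero                   u≢v = ⊥-elim (u≢v refl)
  separates zero                   (suc zero)             _   = suc zero , λ ()
  separates zero                   (suc (suc zero))       _   = suc zero , λ ()
  separates zero                   (suc (suc (suc zero))) _   = suc zero , λ ()
  separates (suc zero)             zero                   _   = suc zero , λ ()
  separates (suc zero)             (suc zero)             u≢v = ⊥-elim (u≢v refl)
  separates (suc zero)             (suc (suc zero))       _   = zero , λ ()
  separates (suc zero)             (suc (suc (suc zero))) _   = zero , λ ()
  separates (suc (suc zero))       zero                   _   = suc zero , λ ()
  separates (suc (suc zero))       (suc zero)             _   = zero , λ ()
  separates (suc (suc zero))       (suc (suc zero))       u≢v = ⊥-elim (u≢v refl)
  separates (suc (suc zero))       (suc (suc (suc zero))) _   = suc zero , λ ()
  separates (suc (suc (suc zero))) zero                   _   = suc zero , λ ()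
  separates (suc (suc (suc zero))) (suc zero)             _   = zero , λ ()
  separates (suc (suc (suc zero))) (suc (suc zero))       _   = suc zero , λ ()
  separates (suc (suc (suc zero))) (suc (suc (suc zero))) u≢v = ⊥-elim (u≢v refl)
  proper : Proper P₄ c
  proper zero                   zero                   ()
  proper zero                   (suc zero)             _  ()
  proper zero                   (suc (suc zero))       _  ()
  proper zero                   (suc (suc (suc zero))) ()
  proper (suc zero)             zero                   _  ()
  proper (suc zero)             (suc zero)             ()
  proper (suc zero)             (suc (suc zero))       ()
  proper (suc zero)             (suc (suc (suc zero))) _  ()
  proper (suc (suc zero))       zero                   _  ()
  proper (suc (suc zero))       (suc zero)             ()
  proper (suc (suc zero))       (suc (suc zero))       ()
  proper (suc (suc zero))       (suc (suc (suc zero))) ()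
  proper (suc (suc (suc zero))) zero                   ()
  proper (suc (suc (suc zero))) (suc zero)             _  ()
  proper (suc (suc (suc zero))) (suc (suc zero))       ()
  proper (suc (suc (suc zero))) (suc (suc (suc zero))) ()
  onto : Surjective _≡_ _≡_ c
  onto = strictlySurjective⇒surjective
    λ { zero → v2 , refl ; (suc zero) → v0 , refl ; (suc (suc zero)) → v1 , refl }

locChrom-P₄ : LocChrom P₄ 3
locChrom-P₄ = (_ , locating-P₄) , fewer
  where
  fewer : ∀ j → suc j ≤ 3 → ¬ HasLocatingColoring P₄ j
  fewer zero                   _ = ¬locating-≤1 P₄ {zero} {suc zero} refl z≤n
  fewer (suc zero)             _ = ¬locating-≤1 P₄ {zero} {suc zero} refl (s≤s z≤n)
  fewer (suc (suc zero))       _ = ¬locating-2-commonNeighbour P₄ {suc (suc zero)} {suc zero} {zero}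
                                     (λ ()) refl refl
  fewer (suc (suc (suc _)))   (s≤s (s≤s (s≤s ())))

theorem3 : ∃ λ (G : Graph) → ∃ λ (Hs : List Graph) →
    Simple G × Connected G × 2 ≤ order G ×
    1 ≤ length Hs × All (λ H → Simple H × Connected H) Hs ×
    ∃ λ (a : ℕ) → ∃ λ (b : ℕ) → ∃ λ (cs : List ℕ) →
      LocChrom (corona G (unionAll Hs)) a × LocChrom G b ×
      Pointwise (λ H c → LocChrom (joinK1 H) c) Hs cs ×
      a ≡ b + sum (map (λ c → c ∸ 1) cs)
theorem3 =
  K₂ , K₁ ∷ [] , simple-K₂ , connected-K₂ , s≤s (s≤s z≤n) ,
  s≤s z≤n , (simple-K₁ , connected-K₁) ∷ [] ,
  3 , 2 , 2 ∷ [] , locChrom-P₄ , locChrom-K₂ , locChrom-K₂ ∷ [] , refl
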